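{- Fix an integer $n\ge 16$. Let $N$ be the largest cardinality of a sum-dominant subset of $\{0,1,\ldots,n-1\}$ that contains both $0$ and $n-1$. Then $n-7\le N\le n-4$.
   Context: For a finite set $A\subseteq\mathbb{N}$, define the sum set $A+A=\{a_i+a_j : a_i,a_j\in A\}$ and the difference set $A-A=\{a_i-a_j : a_i,a_j\in A\}$. The set $A$ is called sum-dominant if $|A+A|>|A-A|$. -}

module Defs where

open import Data.Nat using (ℕ; _≤_)
open import Data.Integer using (ℤ; +_; _+_; _-_; _≟_)
open import Data.Fin using (Fin; toℕ)
open import Data.Fin.Subset using (Subset; _∈_; ∣_∣)
open import Data.Fin.Subset.Properties using (_∈?_)
open import Data.List using (List; map; filter; allFin; cartesianProductWith; deduplicate; length)
open import Data.Product using (Σ; _×_)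
open import Relation.Binary.PropositionalEquality using (_≡_)

elems : {n : ℕ} → Subset n → List ℤ
elems {n} A = map (λ i → + toℕ i) (filter (λ i → i ∈? A) (allFin n))

card : List ℤ → ℕ
card xs = length (deduplicate _≟_ xs)

sumList : {n : ℕ} → Subset n → List ℤ
sumList A = cartesianProductWith _+_ (elems A) (elems A)

diffList : {n : ℕ} → Subset n → List ℤ
diffList A = cartesianProductWith _-_ (elems A) (elems A)

sumSetCard : {n : ℕ} → Subset n → ℕ
sumSetCard A = card (sumList A)

diffSetCard : {n : ℕ} → Subset n → ℕ
diffSetCard A = card (diffList A)

SumDominant : {n : ℕ} → Subset n → Set
SumDominant A = diffSetCard A Data.Nat.< sumSetCard A

Contains : {n : ℕ} → Subset n → ℕ → Set
Contains {n} A k = Σ (Fin n) (λ i → toℕ i ≡ k × i ∈ A)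

Admissible : (n : ℕ) → Subset n → Set
Admissible n A = SumDominant A × Contains A 0 × Contains A (n Data.Nat.∸ 1)

IsLargestAdmissibleCard : ℕ → ℕ → Set
IsLargestAdmissibleCard n N =
  Σ (Subset n) (λ A → Admissible n A × ∣ A ∣ ≡ N)
  × ((A : Subset n) → Admissible n A → ∣ A ∣ ≤ N)

module Submission where

-- Write N = n - 1. For A ⊆ {0,…,N} all sums lie in the window [0, 2N] and all differences in
-- [-N, N], both of width 2N + 1, so comparing |A + A| with |A - A| amounts to comparing how many
-- window values each of them misses; differences are missed in pairs ±d.
--
-- Upper bound: if |A| ≥ n - 3, then A misses at most three points, so for d ≤ N - 3 one of four
-- disjoint pairs (x, x + d) lies in A and d is a difference. Only ±(N - 2) and ±(N - 1) can be
-- missing from A - A, and a case analysis on whether 1, 2, N - 2, N - 1 lie in A shows that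
-- every missing pair ±d is matched by two missing sums among 1, 2, 2N - 2, 2N - 1.
--
-- Lower bound: for n ≥ 19 the set {0,…,N} ∖ {1, 4, 5, 6, N - 6, N - 4, N - 3} misses only the
-- sum 1 but the differences ±(N - 6); for n = 16, 17, 18 explicit sets are checked by evaluation.
-- Admissibility is decidable, so a largest admissible set exists.

open import Defs
open import Data.Bool using (true; false)
open import Data.Fin using (Fin; zero; suc; toℕ; fromℕ<; #_)
open import Data.Fin.Properties using (toℕ<n; toℕ-fromℕ<; toℕ-injective; any?)
open import Data.Fin.Subset using (Subset; _∈_; _∉_; _∪_; ⁅_⁆; ⋃; ∣_∣; ∁)
open import Data.Fin.Subset.Properties
  using (_∈?_; ∣⊥∣≡0; ∣⁅x⁆∣≡1; ∉⊥; x∈⁅x⁆; x∈⁅y⁆⇒x≡y; x∈p∪q⁻; x∈p∪q⁺; q⊆p∪q; p⊂q⇒∣p∣<∣q∣;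
         p⊆q⇒∣p∣≤∣q∣; x∉p⇒x∈∁p; x∈∁p⇒x∉p; ∣∁p∣≡n∸∣p∣; ∣p∣≤n; anySubset?)
open import Data.Integer as ℤ using (ℤ; +_; _⊖_)
import Data.Integer.Properties as ℤ
open import Data.List using (List; []; _∷_; _++_; map; filter; allFin; upTo; length; tabulate; deduplicate)
open import Data.List.Properties using (length-++; length-map; length-upTo)
open import Data.List.Membership.Propositional using () renaming (_∈_ to _∈ˡ_; _∉_ to _∉ˡ_)
open import Data.List.Membership.Propositional.Properties
  using (∈-∃++; ∈-++⁻; ∈-++⁺ˡ; ∈-++⁺ʳ; ∈-filter⁺; ∈-filter⁻; ∈-deduplicate⁺; ∈-deduplicate⁻; ∈-map⁺; ∈-map⁻;
         ∈-allFin; ∈-upTo⁺; ∈-upTo⁻; ∈-cartesianProductWith⁺; ∈-cartesianProductWith⁻; ∈-tabulate⁻)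
open import Data.List.Relation.Binary.Subset.Propositional using (_⊆_)
open import Data.List.Relation.Unary.Any using (here; there)
open import Data.List.Relation.Unary.All using ([]; _∷_; lookup)
open import Data.List.Relation.Unary.All.Properties using (All¬⇒¬Any)
open import Data.List.Relation.Unary.Unique.Propositional using (Unique; []; _∷_)
import Data.List.Relation.Unary.Unique.Propositional.Properties as Unique
import Data.List.Relation.Unary.Unique.DecPropositional.Properties as DecUnique
open import Data.Nat as ℕ using (ℕ; zero; suc; _+_; _*_; _∸_; _/_; _%_; _≤_; _<_; z≤n; s≤s)
import Data.Nat.Properties as ℕ
open import Data.Nat.DivMod using (m<n⇒m%n≡m; [m+n]%n≡m%n)
open import Data.Nat.Tactic.RingSolver using (solve-∀)
open import Data.Product using (Σ; _×_; _,_; proj₁; proj₂; map₂)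
open import Data.Sum using (_⊎_; inj₁; inj₂; [_,_])
open import Data.Vec as Vec using ([]; _∷_)
open import Function using (_∘_)
open import Relation.Binary.Definitions using (DecidableEquality)
open import Relation.Binary.PropositionalEquality hiding ([_])
open import Relation.Nullary using (¬_; ¬?; Dec; yes; no; contradiction)
open import Relation.Nullary.Decidable using (_×-dec_; toWitness)
open import Relation.Unary using (Decidable)
open import Algebra.Properties.CommutativeSemigroup ℕ.+-commutativeSemigroup using (interchange)

unique-⊆-length : {X : Set} {ys zs : List X} → Unique ys → ys ⊆ zs → length ys ≤ length zs
unique-⊆-length {ys = []} _ _ = z≤n
unique-⊆-length {ys = y ∷ ys} (y∉ys ∷ ys!) ys⊆zs
  with zs₁ , zs₂ , refl ← ∈-∃++ (ys⊆zs (here refl)) =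
  ℕ.≤-trans (s≤s (unique-⊆-length ys! ys⊆zs₁zs₂))
          (ℕ.≤-reflexive (trans (cong suc (length-++ zs₁)) (trans (sym (ℕ.+-suc _ _)) (sym (length-++ zs₁)))))
  where
  ys⊆zs₁zs₂ : ys ⊆ zs₁ ++ zs₂
  ys⊆zs₁zs₂ {w} w∈ys with ∈-++⁻ zs₁ (ys⊆zs (there w∈ys))
  ... | inj₁ w∈zs₁ = ∈-++⁺ˡ w∈zs₁
  ... | inj₂ (here refl) = contradiction refl (lookup y∉ys w∈ys)
  ... | inj₂ (there w∈zs₂) = ∈-++⁺ʳ zs₁ w∈zs₂

length-filter-split : {X : Set} {P : X → Set} (P? : Decidable P) (xs : List X) →
  length (filter P? xs) + length (filter (¬? ∘ P?) xs) ≡ length xs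
length-filter-split P? [] = refl
length-filter-split P? (x ∷ xs) with P? x
... | yes _ = cong suc (length-filter-split P? xs)
... | no _ = trans (ℕ.+-suc _ _) (cong suc (length-filter-split P? xs))

module Distinct {X : Set} (_≟_ : DecidableEquality X) where

  open import Data.List.Membership.DecPropositional _≟_ using () renaming (_∈?_ to _∈ˡ?_)

  distinct : List X → ℕ
  distinct xs = length (deduplicate _≟_ xs)

  split-by : (E R : List X) →
    length (filter (λ z → ¬? (z ∈ˡ? E)) R) + length (filter (_∈ˡ? E) R) ≡ length R
  split-by E R = trans (ℕ.+-comm (length (filter (λ z → ¬? (z ∈ˡ? E)) R)) _) (length-filter-split (_∈ˡ? E) R)

  distinct-lower : (R E xs : List X) → Unique R → (∀ {z} → z ∈ˡ R → z ∉ˡ E → z ∈ˡ xs) →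
                   length R ≤ distinct xs + length E
  distinct-lower R E xs R! covered = subst (_≤ distinct xs + length E) (split-by E R)
    (ℕ.+-mono-≤ (unique-⊆-length (Unique.filter⁺ _ R!) outside⊆xs)
              (unique-⊆-length (Unique.filter⁺ _ R!) (λ p → proj₂ (∈-filter⁻ (_∈ˡ? E) {xs = R} p))))
    where
    outside⊆xs : filter (λ z → ¬? (z ∈ˡ? E)) R ⊆ deduplicate _≟_ xs
    outside⊆xs p with z∈R , z∉E ← ∈-filter⁻ (λ z → ¬? (z ∈ˡ? E)) p = ∈-deduplicate⁺ _≟_ (covered z∈R z∉E)

  distinct-upper : (R E xs : List X) → Unique R → Unique E → E ⊆ R → xs ⊆ R →
                   (∀ {z} → z ∈ˡ xs → z ∉ˡ E) → distinct xs + length E ≤ length R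
  distinct-upper R E xs R! E! E⊆R xs⊆R xs∩E=∅ = subst (distinct xs + length E ≤_) (split-by E R)
    (ℕ.+-mono-≤ (unique-⊆-length (DecUnique.deduplicate-! _≟_ xs) xs⊆outside)
              (unique-⊆-length E! (λ p → ∈-filter⁺ (_∈ˡ? E) (E⊆R p) p)))
    where
    xs⊆outside : deduplicate _≟_ xs ⊆ filter (λ z → ¬? (z ∈ˡ? E)) R
    xs⊆outside p = let q = ∈-deduplicate⁻ _≟_ xs p in ∈-filter⁺ (λ z → ¬? (z ∈ˡ? E)) (xs⊆R q) (xs∩E=∅ q)

contains? : {n : ℕ} (A : Subset n) (k : ℕ) → Dec (Contains A k)
contains? A k = any? (λ i → (toℕ i ℕ.≟ k) ×-dec (i ∈? A))

IsSum : {n : ℕ} → Subset n → ℕ → Set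
IsSum A s = Σ ℕ λ a → Σ ℕ λ b → Contains A a × Contains A b × a + b ≡ s

IsDiff : {n : ℕ} → Subset n → ℕ → Set
IsDiff A d = Σ ℕ λ b → Contains A b × Contains A (b + d)

+-⊖-cancel : ∀ m n → (m + n) ⊖ n ≡ + m
+-⊖-cancel m n = trans (ℤ.≤-⊖ (ℕ.m≤n+m n m)) (cong +_ (ℕ.m+n∸n≡m m n))

⊖≡+⇒ : ∀ m n d → m ⊖ n ≡ + d → m ≡ n + d
⊖≡+⇒ m n d m⊖n≡d = ℤ.+-injective (begin
  + m               ≡⟨ sym (+-⊖-cancel m n) ⟩
  (m + n) ⊖ n       ≡⟨ sym (ℤ.distribˡ-⊖-+-pos n m n) ⟩
  (m ⊖ n) ℤ.+ + n   ≡⟨ cong (ℤ._+ + n) m⊖n≡d ⟩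
  + (d + n)         ≡⟨ cong +_ (ℕ.+-comm d n) ⟩
  + (n + d)         ∎)
  where open ≡-Reasoning

module Listing {n : ℕ} (A : Subset n) where

  contains-< : ∀ {k} → Contains A k → k < n
  contains-< (i , refl , _) = toℕ<n i

  ∈elems⁺ : ∀ {k} → Contains A k → + k ∈ˡ elems A
  ∈elems⁺ (i , refl , i∈A) = ∈-map⁺ (λ i → + toℕ i) (∈-filter⁺ (_∈? A) (∈-allFin i) i∈A)

  ∈elems⁻ : ∀ {z} → z ∈ˡ elems A → Σ ℕ λ k → z ≡ + k × Contains A k
  ∈elems⁻ p with i , q , refl ← ∈-map⁻ (λ i → + toℕ i) p =
    toℕ i , refl , i , refl , proj₂ (∈-filter⁻ (_∈? A) {xs = allFin n} q)

  ∈sumList⁺ : ∀ {s} → IsSum A s → + s ∈ˡ sumList A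
  ∈sumList⁺ (a , b , a∈A , b∈A , refl) = ∈-cartesianProductWith⁺ ℤ._+_ (∈elems⁺ a∈A) (∈elems⁺ b∈A)

  ∈sumList⁻ : ∀ {z} → z ∈ˡ sumList A → Σ ℕ λ s → z ≡ + s × IsSum A s
  ∈sumList⁻ p with ∈-cartesianProductWith⁻ ℤ._+_ (elems A) (elems A) p
  ... | x , y , x∈ , y∈ , refl with ∈elems⁻ x∈ | ∈elems⁻ y∈
  ... | a , refl , a∈A | b , refl , b∈A =
    a + b , refl , a , b , a∈A , b∈A , refl

  ∈diffList⁻ : ∀ {z} → z ∈ˡ diffList A → Σ ℕ λ a → Σ ℕ λ b → Contains A a × Contains A b × z ≡ a ⊖ b
  ∈diffList⁻ p with ∈-cartesianProductWith⁻ ℤ._-_ (elems A) (elems A) p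
  ... | x , y , x∈ , y∈ , refl with ∈elems⁻ x∈ | ∈elems⁻ y∈
  ... | a , refl , a∈A | b , refl , b∈A =
    a , b , a∈A , b∈A , ℤ.[+m]-[+n]≡m⊖n a b

  private
    shift-⊖ : ∀ b d → (b + d) ⊖ b ≡ + d
    shift-⊖ b d = trans (cong (_⊖ b) (ℕ.+-comm b d)) (+-⊖-cancel d b)

  ∈diffList⁺ : ∀ {d} → IsDiff A d → + d ∈ˡ diffList A
  ∈diffList⁺ {d} (b , b∈A , c∈A) =
    subst (_∈ˡ diffList A) (trans (ℤ.[+m]-[+n]≡m⊖n (b + d) b) (shift-⊖ b d))
      (∈-cartesianProductWith⁺ ℤ._-_ (∈elems⁺ c∈A) (∈elems⁺ b∈A))

  ∈diffList⁺-neg : ∀ {d} → IsDiff A d → ℤ.- (+ d) ∈ˡ diffList A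
  ∈diffList⁺-neg {d} (b , b∈A , c∈A) =
    subst (_∈ˡ diffList A) (trans (ℤ.[+m]-[+n]≡m⊖n b (b + d)) (trans (ℤ.⊖-swap b (b + d)) (cong ℤ.-_ (shift-⊖ b d))))
      (∈-cartesianProductWith⁺ ℤ._-_ (∈elems⁺ b∈A) (∈elems⁺ c∈A))

module Window (N : ℕ) (A : Subset (suc N)) where

  open Listing A
  open Distinct ℤ._≟_ using (distinct-lower; distinct-upper)

  width : ℕ
  width = suc (N + N)

  contains-≤ : ∀ {k} → Contains A k → k ≤ N
  contains-≤ k∈A = ℕ.≤-pred (contains-< k∈A)

  sumWindow : List ℤ
  sumWindow = map +_ (upTo width)

  sumWindow! : Unique sumWindow
  sumWindow! = Unique.map⁺ ℤ.+-injective (Unique.upTo⁺ width)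

  |sumWindow| : length sumWindow ≡ width
  |sumWindow| = trans (length-map +_ (upTo width)) (length-upTo width)

  diffWindow : List ℤ
  diffWindow = map (_⊖ N) (upTo width)

  ⊖N-injective : ∀ {k j} → k ⊖ N ≡ j ⊖ N → k ≡ j
  ⊖N-injective {k} {j} e = ℤ.+-injective (begin
    + k               ≡⟨ sym (+-⊖-cancel k N) ⟩
    (k + N) ⊖ N       ≡⟨ sym (ℤ.distribˡ-⊖-+-pos N k N) ⟩
    (k ⊖ N) ℤ.+ + N   ≡⟨ cong (ℤ._+ + N) e ⟩
    (j ⊖ N) ℤ.+ + N   ≡⟨ ℤ.distribˡ-⊖-+-pos N j N ⟩
    (j + N) ⊖ N       ≡⟨ +-⊖-cancel j N ⟩
    + j               ∎)
    where open ≡-Reasoning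

  diffWindow! : Unique diffWindow
  diffWindow! = Unique.map⁺ ⊖N-injective (Unique.upTo⁺ width)

  |diffWindow| : length diffWindow ≡ width
  |diffWindow| = trans (length-map _ (upTo width)) (length-upTo width)

  sums-lower : (Es : List ℕ) → (∀ s → s ≤ N + N → s ∉ˡ Es → IsSum A s) →
               width ≤ sumSetCard A + length Es
  sums-lower Es covered = subst₂ _≤_ |sumWindow| (cong (λ t → sumSetCard A + t) (length-map +_ Es))
    (distinct-lower sumWindow (map +_ Es) (sumList A) sumWindow! in-sums)
    where
    in-sums : ∀ {z} → z ∈ˡ sumWindow → z ∉ˡ map +_ Es → z ∈ˡ sumList A
    in-sums z∈ z∉Es with s , s<w , refl ← ∈-map⁻ +_ z∈ =
      ∈sumList⁺ (covered s (ℕ.≤-pred (∈-upTo⁻ s<w)) (λ s∈Es → z∉Es (∈-map⁺ +_ s∈Es)))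

  sums-upper : (Es : List ℕ) → Unique Es → (∀ {s} → s ∈ˡ Es → s ≤ N + N) →
               (∀ s → IsSum A s → s ∉ˡ Es) → sumSetCard A + length Es ≤ width
  sums-upper Es Es! Es≤2N missing = subst₂ _≤_ (cong (λ t → sumSetCard A + t) (length-map +_ Es)) |sumWindow|
    (distinct-upper sumWindow (map +_ Es) (sumList A) sumWindow! (Unique.map⁺ ℤ.+-injective Es!)
      Es⊆window sums⊆window sums∉Es)
    where
    Es⊆window : ∀ {z} → z ∈ˡ map +_ Es → z ∈ˡ sumWindow
    Es⊆window z∈ with s , s∈Es , refl ← ∈-map⁻ +_ z∈ = ∈-map⁺ +_ (∈-upTo⁺ (s≤s (Es≤2N s∈Es)))
    sums⊆window : ∀ {z} → z ∈ˡ sumList A → z ∈ˡ sumWindow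
    sums⊆window z∈ with _ , refl , a , b , a∈A , b∈A , refl ← ∈sumList⁻ z∈ =
      ∈-map⁺ +_ (∈-upTo⁺ (s≤s (ℕ.+-mono-≤ (contains-≤ a∈A) (contains-≤ b∈A))))
    sums∉Es : ∀ {z} → z ∈ˡ sumList A → z ∉ˡ map +_ Es
    sums∉Es z∈ z∈Es with s , refl , s-sum ← ∈sumList⁻ z∈ with s' , s'∈Es , e ← ∈-map⁻ +_ z∈Es =
      missing s s-sum (subst (_∈ˡ Es) (sym (ℤ.+-injective e)) s'∈Es)

  signed : List ℕ → List ℤ
  signed Ed = map +_ Ed ++ map (λ d → ℤ.- (+ d)) Ed

  diffs-lower : (Ed : List ℕ) → (∀ d → d ≤ N → d ∉ˡ Ed → IsDiff A d) →
                width ≤ diffSetCard A + (length Ed + length Ed)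
  diffs-lower Ed covered = subst₂ _≤_ |diffWindow| (cong (λ t → diffSetCard A + t) |signed|)
    (distinct-lower diffWindow (signed Ed) (diffList A) diffWindow! in-diffs)
    where
    |signed| : length (signed Ed) ≡ length Ed + length Ed
    |signed| = trans (length-++ (map +_ Ed)) (cong₂ _+_ (length-map +_ Ed) (length-map _ Ed))
    in-diffs : ∀ {z} → z ∈ˡ diffWindow → z ∉ˡ signed Ed → z ∈ˡ diffList A
    in-diffs z∈ z∉ with k , k<w , refl ← ∈-map⁻ (_⊖ N) z∈ with N ℕ.≤? k
    ... | yes N≤k = subst (_∈ˡ diffList A) (sym (ℤ.≤-⊖ N≤k))
          (∈diffList⁺ (covered (k ∸ N) k∸N≤N
            (λ p → z∉ (subst (_∈ˡ signed Ed) (sym (ℤ.≤-⊖ N≤k)) (∈-++⁺ˡ (∈-map⁺ +_ p))))))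
      where
      k∸N≤N : k ∸ N ≤ N
      k∸N≤N = subst (k ∸ N ≤_) (ℕ.m+n∸m≡n N N) (ℕ.∸-monoˡ-≤ N (ℕ.≤-pred (∈-upTo⁻ k<w)))
    ... | no N≰k = subst (_∈ˡ diffList A) (sym (ℤ.⊖-≰ N≰k))
          (∈diffList⁺-neg (covered (N ∸ k) (ℕ.m∸n≤m N k)
            (λ p → z∉ (subst (_∈ˡ signed Ed) (sym (ℤ.⊖-≰ N≰k)) (∈-++⁺ʳ (map +_ Ed) (∈-map⁺ _ p))))))

  -- every difference a - b = (a + (N - b)) - N of elements of A lies in the difference window
  diffs⊆diffWindow : ∀ {z} → z ∈ˡ diffList A → z ∈ˡ diffWindow
  diffs⊆diffWindow z∈ with a , b , a∈A , b∈A , refl ← ∈diffList⁻ z∈ = subst (_∈ˡ diffWindow) shift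
    (∈-map⁺ (_⊖ N) (∈-upTo⁺ (s≤s (ℕ.+-mono-≤ (contains-≤ a∈A) (ℕ.m∸n≤m N b)))))
    where
    shift : (a + (N ∸ b)) ⊖ N ≡ a ⊖ b
    shift = begin
      (a + (N ∸ b)) ⊖ N             ≡⟨ cong ((a + (N ∸ b)) ⊖_) (sym (ℕ.m+[n∸m]≡n (contains-≤ b∈A))) ⟩
      (a + (N ∸ b)) ⊖ (b + (N ∸ b)) ≡⟨ cong₂ _⊖_ (ℕ.+-comm a (N ∸ b)) (ℕ.+-comm b (N ∸ b)) ⟩
      ((N ∸ b) + a) ⊖ ((N ∸ b) + b) ≡⟨ ℤ.+-cancelˡ-⊖ (N ∸ b) a b ⟩
      a ⊖ b                         ∎
      where open ≡-Reasoning

  diffs-upper : (d : ℕ) → 1 ≤ d → d ≤ N → ¬ IsDiff A d → diffSetCard A + 2 ≤ width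
  diffs-upper d 1≤d d≤N d-missing = subst (diffSetCard A + 2 ≤_) |diffWindow|
    (distinct-upper diffWindow ±d (diffList A) diffWindow! ±d! ±d⊆window diffs⊆diffWindow diffs∉±d)
    where
    ±d : List ℤ
    ±d = + d ∷ ℤ.- (+ d) ∷ []
    ±d! : Unique ±d
    ±d! = (+d≢-d 1≤d ∷ []) ∷ [] ∷ []
      where
      +d≢-d : ∀ {d} → 1 ≤ d → + d ≢ ℤ.- (+ d)
      +d≢-d {suc _} _ ()
    ±d⊆window : ∀ {z} → z ∈ˡ ±d → z ∈ˡ diffWindow
    ±d⊆window (here refl) =
      subst (_∈ˡ diffWindow) (+-⊖-cancel d N) (∈-map⁺ (_⊖ N) (∈-upTo⁺ (s≤s (ℕ.+-monoˡ-≤ N d≤N))))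
    ±d⊆window (there (here refl)) =
      subst (_∈ˡ diffWindow) (trans (ℤ.⊖-≤ (ℕ.m∸n≤m N d)) (cong (λ x → ℤ.- (+ x)) (ℕ.m∸[m∸n]≡n d≤N)))
        (∈-map⁺ (_⊖ N) (∈-upTo⁺ (s≤s (ℕ.≤-trans (ℕ.m∸n≤m N d) (ℕ.m≤m+n N N)))))
    diffs∉±d : ∀ {z} → z ∈ˡ diffList A → z ∉ˡ ±d
    diffs∉±d z∈ z∈±d with ∈diffList⁻ z∈
    diffs∉±d _ (here a⊖b≡d) | a , b , a∈A , b∈A , refl =
      d-missing (b , b∈A , subst (Contains A) (⊖≡+⇒ a b d a⊖b≡d) a∈A)
    diffs∉±d _ (there (here a⊖b≡-d)) | a , b , a∈A , b∈A , refl =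
      d-missing (a , a∈A , subst (Contains A) (⊖≡+⇒ b a d b⊖a≡d) b∈A)
      where
      b⊖a≡d : b ⊖ a ≡ + d
      b⊖a≡d = trans (ℤ.⊖-swap b a) (trans (cong ℤ.-_ a⊖b≡-d) (ℤ.neg-involutive (+ d)))

  dominant-if : (s₀ : ℕ) → (∀ s → s ≤ N + N → s ≢ s₀ → IsSum A s) →
                (d : ℕ) → 1 ≤ d → d ≤ N → ¬ IsDiff A d → SumDominant A
  dominant-if s₀ covered d 1≤d d≤N d-missing = ℕ.+-cancelʳ-≤ 1 _ _
    (subst (_≤ sumSetCard A + 1) (ℕ.+-suc (diffSetCard A) 1)
      (ℕ.≤-trans (diffs-upper d 1≤d d≤N d-missing)
                 (sums-lower (s₀ ∷ []) (λ s s≤2N s∉ → covered s s≤2N (λ s≡s₀ → s∉ (here s≡s₀))))))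

  not-dominant-if : (Es Ed : List ℕ) → Unique Es → (∀ {s} → s ∈ˡ Es → s ≤ N + N) →
                    (∀ s → IsSum A s → s ∉ˡ Es) → (∀ d → d ≤ N → d ∉ˡ Ed → IsDiff A d) →
                    length Es ≡ length Ed + length Ed → ¬ SumDominant A
  not-dominant-if Es Ed Es! Es≤2N sums∉Es covered |Es|≡2|Ed| dominant =
    ℕ.<⇒≱ dominant (ℕ.+-cancelʳ-≤ (length Es) _ _
      (ℕ.≤-trans (sums-upper Es Es! Es≤2N sums∉Es)
        (subst (λ t → width ≤ diffSetCard A + t) (sym |Es|≡2|Ed|) (diffs-lower Ed covered))))

∣p∪q∣≤∣p∣+∣q∣ : {n : ℕ} (p q : Subset n) → ∣ p ∪ q ∣ ≤ ∣ p ∣ + ∣ q ∣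
∣p∪q∣≤∣p∣+∣q∣ [] [] = z≤n
∣p∪q∣≤∣p∣+∣q∣ (true ∷ p) (true ∷ q) = s≤s (ℕ.≤-trans (∣p∪q∣≤∣p∣+∣q∣ p q) (ℕ.+-monoʳ-≤ ∣ p ∣ (ℕ.n≤1+n ∣ q ∣)))
∣p∪q∣≤∣p∣+∣q∣ (true ∷ p) (false ∷ q) = s≤s (∣p∪q∣≤∣p∣+∣q∣ p q)
∣p∪q∣≤∣p∣+∣q∣ (false ∷ p) (true ∷ q) = ℕ.≤-trans (s≤s (∣p∪q∣≤∣p∣+∣q∣ p q)) (ℕ.≤-reflexive (sym (ℕ.+-suc ∣ p ∣ ∣ q ∣)))
∣p∪q∣≤∣p∣+∣q∣ (false ∷ p) (false ∷ q) = ∣p∪q∣≤∣p∣+∣q∣ p q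

pointSet : {n : ℕ} → List (Fin n) → Subset n
pointSet ps = ⋃ (map ⁅_⁆ ps)

∈pointSet⁻ : {n : ℕ} (ps : List (Fin n)) {i : Fin n} → i ∈ pointSet ps → i ∈ˡ ps
∈pointSet⁻ [] i∈ = contradiction i∈ ∉⊥
∈pointSet⁻ (p ∷ ps) i∈ with x∈p∪q⁻ ⁅ p ⁆ (pointSet ps) i∈
... | inj₁ i∈⁅p⁆ = here (x∈⁅y⁆⇒x≡y p i∈⁅p⁆)
... | inj₂ i∈ps = there (∈pointSet⁻ ps i∈ps)

∈pointSet⁺ : {n : ℕ} (ps : List (Fin n)) {i : Fin n} → i ∈ˡ ps → i ∈ pointSet ps
∈pointSet⁺ (p ∷ ps) (here refl) = x∈p∪q⁺ (inj₁ (x∈⁅x⁆ p))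
∈pointSet⁺ (p ∷ ps) (there i∈ps) = x∈p∪q⁺ (inj₂ (∈pointSet⁺ ps i∈ps))

∣pointSet∣≤length : {n : ℕ} (ps : List (Fin n)) → ∣ pointSet ps ∣ ≤ length ps
∣pointSet∣≤length {n} [] = ℕ.≤-reflexive (∣⊥∣≡0 n)
∣pointSet∣≤length (p ∷ ps) = ℕ.≤-trans (∣p∪q∣≤∣p∣+∣q∣ ⁅ p ⁆ (pointSet ps))
  (subst (λ t → t + ∣ pointSet ps ∣ ≤ suc (length ps)) (sym (∣⁅x⁆∣≡1 p)) (s≤s (∣pointSet∣≤length ps)))

length≤∣pointSet∣ : {n : ℕ} (ps : List (Fin n)) → Unique ps → length ps ≤ ∣ pointSet ps ∣
length≤∣pointSet∣ [] [] = z≤n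
length≤∣pointSet∣ (p ∷ ps) (p∉ps ∷ ps!) = ℕ.≤-trans (s≤s (length≤∣pointSet∣ ps ps!))
  (p⊂q⇒∣p∣<∣q∣ (q⊆p∪q ⁅ p ⁆ (pointSet ps) , p , x∈p∪q⁺ (inj₁ (x∈⁅x⁆ p)) ,
                λ p∈ps → lookup p∉ps (∈pointSet⁻ ps p∈ps) refl))

outside-points : {n : ℕ} (A : Subset n) (ps : List (Fin n)) → Unique ps →
                 (∀ {i} → i ∈ˡ ps → i ∉ A) → length ps + ∣ A ∣ ≤ n
outside-points A ps ps! ps∩A=∅ = ℕ.m≤o∸n⇒m+n≤o (length ps) (∣p∣≤n A)
  (ℕ.≤-trans (length≤∣pointSet∣ ps ps!)
    (subst (∣ pointSet ps ∣ ≤_) (∣∁p∣≡n∸∣p∣ A)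
      (p⊆q⇒∣p∣≤∣q∣ (λ i∈ → x∉p⇒x∈∁p (ps∩A=∅ (∈pointSet⁻ ps i∈))))))

module Dense {N : ℕ} (A : Subset (suc N)) (dense : suc N < 4 + ∣ A ∣) where

  no-four-missing : (f : Fin 4 → ℕ) (label : ℕ → ℕ) → (∀ i → label (f i) ≡ toℕ i) →
                    (∀ i → f i ≤ N) → ¬ (∀ i → ¬ Contains A (f i))
  no-four-missing f label labelled f≤N all-missing = ℕ.<⇒≱ dense (outside-points A points points! points∉A)
    where
    point : Fin 4 → Fin (suc N)
    point i = fromℕ< (s≤s (f≤N i))
    points : List (Fin (suc N))
    points = tabulate point
    point-injective : ∀ {i j} → point i ≡ point j → i ≡ j
    point-injective {i} {j} e = toℕ-injective (begin
      toℕ i                ≡⟨ sym (labelled i) ⟩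
      label (f i)          ≡⟨ cong label (sym (toℕ-fromℕ< (s≤s (f≤N i)))) ⟩
      label (toℕ (point i)) ≡⟨ cong (label ∘ toℕ) e ⟩
      label (toℕ (point j)) ≡⟨ cong label (toℕ-fromℕ< (s≤s (f≤N j))) ⟩
      label (f j)          ≡⟨ labelled j ⟩
      toℕ j                ∎)
      where open ≡-Reasoning
    points! : Unique points
    points! = Unique.tabulate⁺ point-injective
    points∉A : ∀ {x} → x ∈ˡ points → x ∉ A
    points∉A x∈ x∈A with i , refl ← ∈-tabulate⁻ {f = point} x∈ = all-missing i (point i , toℕ-fromℕ< (s≤s (f≤N i)) , x∈A)

  diff-from-pairs : (d : ℕ) (a : Fin 4 → ℕ) (label : ℕ → ℕ) → (∀ i → label (a i) ≡ toℕ i) →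
                    (∀ i → label (a i + d) ≡ toℕ i) → (∀ i → a i + d ≤ N) → IsDiff A d
  diff-from-pairs d a label lower upper bound
    with any? (λ i → contains? A (a i) ×-dec contains? A (a i + d))
  ... | yes (i , a∈A , b∈A) = a i , a∈A , b∈A
  ... | no no-pair = contradiction (λ i → proj₂ (proj₂ (proj₂ (missing-end i))))
                       (no-four-missing (proj₁ ∘ missing-end) label
                         (λ i → proj₁ (proj₂ (missing-end i))) (λ i → proj₁ (proj₂ (proj₂ (missing-end i)))))
    where
    missing-end : ∀ i → Σ ℕ λ x → label x ≡ toℕ i × x ≤ N × ¬ Contains A x
    missing-end i with contains? A (a i)
    ... | no a∉A = a i , lower i , ℕ.m+n≤o⇒m≤o (a i) (bound i) , a∉A
    ... | yes a∈A = a i + d , upper i , bound i , λ b∈A → no-pair (i , a∈A , b∈A)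

every : {P : Fin 4 → Set} → P zero → P (suc zero) → P (suc (suc zero)) → P (suc (suc (suc zero))) → ∀ i → P i
every p₀ p₁ p₂ p₃ zero = p₀
every p₀ p₁ p₂ p₃ (suc zero) = p₁
every p₀ p₁ p₂ p₃ (suc (suc zero)) = p₂
every p₀ p₁ p₂ p₃ (suc (suc (suc zero))) = p₃

top-three : ∀ m d → d ≤ 3 + m → m < d → d ≡ 1 + m ⊎ d ≡ 2 + m ⊎ d ≡ 3 + m
top-three zero 1 _ _ = inj₁ refl
top-three zero 2 _ _ = inj₂ (inj₁ refl)
top-three zero 3 _ _ = inj₂ (inj₂ refl)
top-three zero (suc (suc (suc (suc _)))) (s≤s (s≤s (s≤s ()))) _
top-three (suc m) (suc d) (s≤s d≤) (s≤s m<d) with top-three m d d≤ m<d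
... | inj₁ e = inj₁ (cong suc e)
... | inj₂ (inj₁ e) = inj₂ (inj₁ (cong suc e))
... | inj₂ (inj₂ e) = inj₂ (inj₂ (cong suc e))

module EdgeSums {N : ℕ} (A : Subset (suc N)) where

  open Window N A using (contains-≤)

  sum-one : IsSum A 1 → Contains A 1
  sum-one (0 , b , _ , b∈A , refl) = b∈A
  sum-one (1 , 0 , a∈A , _ , _) = a∈A

  sum-two : IsSum A 2 → Contains A 1 ⊎ Contains A 2
  sum-two (0 , b , _ , b∈A , refl) = inj₂ b∈A
  sum-two (1 , 1 , a∈A , _ , _) = inj₁ a∈A
  sum-two (2 , 0 , a∈A , _ , _) = inj₂ a∈A

  deficits : ∀ {a b} c → a ≤ N → b ≤ N → c + (a + b) ≡ N + N → (N ∸ a) + (N ∸ b) ≡ c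
  deficits {a} {b} c a≤N b≤N e = ℕ.+-cancelʳ-≡ (a + b) _ c (begin
    ((N ∸ a) + (N ∸ b)) + (a + b) ≡⟨ interchange (N ∸ a) (N ∸ b) a b ⟩
    ((N ∸ a) + a) + ((N ∸ b) + b) ≡⟨ cong₂ _+_ (ℕ.m∸n+n≡m a≤N) (ℕ.m∸n+n≡m b≤N) ⟩
    N + N                         ≡⟨ sym e ⟩
    c + (a + b)                   ∎)
    where open ≡-Reasoning

  deficit : ∀ {a} e → Contains A a → N ∸ a ≡ e → Contains A (N ∸ e)
  deficit e a∈A refl = subst (Contains A) (sym (ℕ.m∸[m∸n]≡n (contains-≤ a∈A))) a∈A

  sum-2N-1 : ∀ s → 1 + s ≡ N + N → IsSum A s → Contains A (N ∸ 1)
  sum-2N-1 s e (a , b , a∈A , b∈A , refl)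
    with N ∸ a in ea | N ∸ b in eb | deficits 1 (contains-≤ a∈A) (contains-≤ b∈A) e
  ... | 1 | 0 | _ = deficit 1 a∈A ea
  ... | 0 | 1 | _ = deficit 1 b∈A eb

  sum-2N-2 : ∀ s → 2 + s ≡ N + N → IsSum A s → Contains A (N ∸ 1) ⊎ Contains A (N ∸ 2)
  sum-2N-2 s e (a , b , a∈A , b∈A , refl)
    with N ∸ a in ea | N ∸ b in eb | deficits 2 (contains-≤ a∈A) (contains-≤ b∈A) e
  ... | 2 | 0 | _ = inj₂ (deficit 2 a∈A ea)
  ... | 1 | 1 | _ = inj₁ (deficit 1 a∈A ea)
  ... | 0 | 2 | _ = inj₂ (deficit 2 b∈A eb)

-- the labelling ⌊x / 2d⌋·d + (x mod d) numbers the disjoint pairs (x, x + d) with x mod 2d < d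
pair-label : (d : ℕ) → .{{ℕ.NonZero d}} → ℕ → ℕ
pair-label d x = _/_ x (2 * d) {{ℕ.m*n≢0 2 d}} * d + x % d

-- Upper bound: for n = 16 + k (N = n - 1 = 15 + k), a set A ⊆ {0,…,N} containing 0 and N and
-- missing at most three points is not sum-dominant.
module LargeSets (k : ℕ) (A : Subset (16 + k)) (dense : 16 + k < 4 + ∣ A ∣)
                 (0∈A : Contains A 0) (N∈A : Contains A (15 + k)) where

  open Dense A dense using (diff-from-pairs)
  open EdgeSums A
  open Window (15 + k) A using (not-dominant-if)

  private
    -- the pairs used for d ≤ 3 end at most at 9 ≤ N
    below : ∀ c → c ≤ 9 → c ≤ 15 + k
    below c c≤9 = ℕ.≤-trans c≤9 (ℕ.m≤m+n 9 (6 + k))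

  -- Every d ≤ N - 3 is a difference, as one of four disjoint pairs (x, x + d) lies in A; the
  -- pairs start at 0,2,4,6 (d = 1), 0,1,4,5 (d = 2), 0,1,2,6 (d = 3) and 0,1,2,3 (d ≥ 4, told
  -- apart by residues mod d).
  small-diff : ∀ d → d ≤ 12 + k → IsDiff A d
  small-diff 0 _ = 0 , 0∈A , 0∈A
  small-diff 1 _ = diff-from-pairs 1 (Vec.lookup (0 ∷ 2 ∷ 4 ∷ 6 ∷ [])) (pair-label 1)
    (every refl refl refl refl) (every refl refl refl refl)
    (every (below 1 (s≤s z≤n)) (below 3 (ℕ.≤ᵇ⇒≤ 3 9 _)) (below 5 (ℕ.≤ᵇ⇒≤ 5 9 _)) (below 7 (ℕ.≤ᵇ⇒≤ 7 9 _)))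
  small-diff 2 _ = diff-from-pairs 2 (Vec.lookup (0 ∷ 1 ∷ 4 ∷ 5 ∷ [])) (pair-label 2)
    (every refl refl refl refl) (every refl refl refl refl)
    (every (below 2 (ℕ.≤ᵇ⇒≤ 2 9 _)) (below 3 (ℕ.≤ᵇ⇒≤ 3 9 _)) (below 6 (ℕ.≤ᵇ⇒≤ 6 9 _)) (below 7 (ℕ.≤ᵇ⇒≤ 7 9 _)))
  small-diff 3 _ = diff-from-pairs 3 (Vec.lookup (0 ∷ 1 ∷ 2 ∷ 6 ∷ [])) (pair-label 3)
    (every refl refl refl refl) (every refl refl refl refl)
    (every (below 3 (ℕ.≤ᵇ⇒≤ 3 9 _)) (below 4 (ℕ.≤ᵇ⇒≤ 4 9 _)) (below 5 (ℕ.≤ᵇ⇒≤ 5 9 _)) (below 9 ℕ.≤-refl))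
  small-diff d@(suc (suc (suc (suc m)))) (s≤s (s≤s (s≤s (s≤s m≤8+k)))) =
    diff-from-pairs d toℕ (_% d) (λ i → m<n⇒m%n≡m (i<d i))
      (λ i → trans ([m+n]%n≡m%n (toℕ i) d) (m<n⇒m%n≡m (i<d i)))
      (λ i → ℕ.+-mono-≤ (ℕ.≤-pred (toℕ<n i)) (s≤s (s≤s (s≤s (s≤s m≤8+k)))))
    where
    i<d : (i : Fin 4) → toℕ i < d
    i<d i = ℕ.≤-trans (toℕ<n i) (s≤s (s≤s (s≤s (s≤s z≤n))))

  diffs-except : (Ed : List ℕ) → (13 + k ∉ˡ Ed → IsDiff A (13 + k)) → (14 + k ∉ˡ Ed → IsDiff A (14 + k)) →
                 ∀ d → d ≤ 15 + k → d ∉ˡ Ed → IsDiff A d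
  diffs-except Ed d₁₃ d₁₄ d d≤N d∉Ed with d ℕ.≤? 12 + k
  ... | yes d≤N-3 = small-diff d d≤N-3
  ... | no d≰N-3 with top-three (12 + k) d d≤N (ℕ.≰⇒> d≰N-3)
  ...   | inj₁ refl = d₁₃ d∉Ed
  ...   | inj₂ (inj₁ refl) = d₁₄ d∉Ed
  ...   | inj₂ (inj₂ refl) = 0 , 0∈A , N∈A

  private
    2N-1≤2N : (14 + k) + (15 + k) ≤ (15 + k) + (15 + k)
    2N-1≤2N = ℕ.+-monoˡ-≤ (15 + k) (ℕ.n≤1+n (14 + k))
    2N-2≤2N : (13 + k) + (15 + k) ≤ (15 + k) + (15 + k)
    2N-2≤2N = ℕ.+-monoˡ-≤ (15 + k) (ℕ.≤-trans (ℕ.n≤1+n (13 + k)) (ℕ.n≤1+n (14 + k)))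

  -- If N - 2 and N - 1 are differences, A - A fills its whole window.
  all-diffs : IsDiff A (13 + k) → IsDiff A (14 + k) → ¬ SumDominant A
  all-diffs d₁₃ d₁₄ =
    not-dominant-if [] [] [] (λ ()) (λ _ _ ()) (diffs-except [] (λ _ → d₁₃) (λ _ → d₁₄)) refl

  -- 1, N - 1 ∉ A: the sums 1 and 2N - 1 are missing, while only ±(N - 1) can be.
  without-1,N-1 : ¬ Contains A 1 → ¬ Contains A (14 + k) → IsDiff A (13 + k) → ¬ SumDominant A
  without-1,N-1 1∉A N-1∉A d₁₃ = not-dominant-if Es (14 + k ∷ []) (((λ ()) ∷ []) ∷ [] ∷ []) Es≤2N sums∉Es
    (diffs-except (14 + k ∷ []) (λ _ → d₁₃) (λ d∉ → contradiction (here refl) d∉)) refl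
    where
    Es = 1 ∷ (14 + k) + (15 + k) ∷ []
    Es≤2N : ∀ {s} → s ∈ˡ Es → s ≤ (15 + k) + (15 + k)
    Es≤2N (here refl) = s≤s z≤n
    Es≤2N (there (here refl)) = 2N-1≤2N
    sums∉Es : ∀ s → IsSum A s → s ∉ˡ Es
    sums∉Es s s∈A+A (here refl) = 1∉A (sum-one s∈A+A)
    sums∉Es s s∈A+A (there (here refl)) = N-1∉A (sum-2N-1 s refl s∈A+A)

  -- 1, 2 ∉ A: the sums 1 and 2 are missing, while only ±(N - 2) can be.
  without-1,2 : ¬ Contains A 1 → ¬ Contains A 2 → IsDiff A (14 + k) → ¬ SumDominant A
  without-1,2 1∉A 2∉A d₁₄ = not-dominant-if Es (13 + k ∷ []) (((λ ()) ∷ []) ∷ [] ∷ []) Es≤2N sums∉Es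
    (diffs-except (13 + k ∷ []) (λ d∉ → contradiction (here refl) d∉) (λ _ → d₁₄)) refl
    where
    Es = 1 ∷ 2 ∷ []
    Es≤2N : ∀ {s} → s ∈ˡ Es → s ≤ (15 + k) + (15 + k)
    Es≤2N (here refl) = s≤s z≤n
    Es≤2N (there (here refl)) = s≤s (s≤s z≤n)
    sums∉Es : ∀ s → IsSum A s → s ∉ˡ Es
    sums∉Es s s∈A+A (here refl) = 1∉A (sum-one s∈A+A)
    sums∉Es s s∈A+A (there (here refl)) = [ 1∉A , 2∉A ] (sum-two s∈A+A)

  -- N - 1, N - 2 ∉ A: the sums 2N - 1 and 2N - 2 are missing, while only ±(N - 2) can be.
  without-N-1,N-2 : ¬ Contains A (14 + k) → ¬ Contains A (13 + k) → IsDiff A (14 + k) → ¬ SumDominant A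
  without-N-1,N-2 N-1∉A N-2∉A d₁₄ = not-dominant-if Es (13 + k ∷ []) ((ℕ.1+n≢n ∷ []) ∷ [] ∷ []) Es≤2N sums∉Es
    (diffs-except (13 + k ∷ []) (λ d∉ → contradiction (here refl) d∉) (λ _ → d₁₄)) refl
    where
    Es = (14 + k) + (15 + k) ∷ (13 + k) + (15 + k) ∷ []
    Es≤2N : ∀ {s} → s ∈ˡ Es → s ≤ (15 + k) + (15 + k)
    Es≤2N (here refl) = 2N-1≤2N
    Es≤2N (there (here refl)) = 2N-2≤2N
    sums∉Es : ∀ s → IsSum A s → s ∉ˡ Es
    sums∉Es s s∈A+A (here refl) = N-1∉A (sum-2N-1 s refl s∈A+A)
    sums∉Es s s∈A+A (there (here refl)) = [ N-1∉A , N-2∉A ] (sum-2N-2 s refl s∈A+A)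

  -- 1, 2, N - 2, N - 1 ∉ A: four sums are missing, while only ±(N - 2), ±(N - 1) can be.
  without-corners : ¬ Contains A 1 → ¬ Contains A 2 → ¬ Contains A (14 + k) → ¬ Contains A (13 + k) →
                    ¬ SumDominant A
  without-corners 1∉A 2∉A N-1∉A N-2∉A = not-dominant-if Es (13 + k ∷ 14 + k ∷ []) Es! Es≤2N sums∉Es
    (diffs-except (13 + k ∷ 14 + k ∷ []) (λ d∉ → contradiction (here refl) d∉)
                  (λ d∉ → contradiction (there (here refl)) d∉)) refl
    where
    Es = 1 ∷ 2 ∷ (14 + k) + (15 + k) ∷ (13 + k) + (15 + k) ∷ []
    Es! : Unique Es
    Es! = ((λ ()) ∷ (λ ()) ∷ (λ ()) ∷ []) ∷ ((λ ()) ∷ (λ ()) ∷ []) ∷ (ℕ.1+n≢n ∷ []) ∷ [] ∷ []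
    Es≤2N : ∀ {s} → s ∈ˡ Es → s ≤ (15 + k) + (15 + k)
    Es≤2N (here refl) = s≤s z≤n
    Es≤2N (there (here refl)) = s≤s (s≤s z≤n)
    Es≤2N (there (there (here refl))) = 2N-1≤2N
    Es≤2N (there (there (there (here refl)))) = 2N-2≤2N
    sums∉Es : ∀ s → IsSum A s → s ∉ˡ Es
    sums∉Es s s∈A+A (here refl) = 1∉A (sum-one s∈A+A)
    sums∉Es s s∈A+A (there (here refl)) = [ 1∉A , 2∉A ] (sum-two s∈A+A)
    sums∉Es s s∈A+A (there (there (here refl))) = N-1∉A (sum-2N-1 s refl s∈A+A)
    sums∉Es s s∈A+A (there (there (there (here refl)))) = [ N-1∉A , N-2∉A ] (sum-2N-2 s refl s∈A+A)

  not-dominant : ¬ SumDominant A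
  not-dominant with contains? A 1 | contains? A (14 + k) | contains? A 2 | contains? A (13 + k)
  ... | yes 1∈A | yes N-1∈A | _        | _         = all-diffs (1 , 1∈A , N-1∈A) (1 , 1∈A , N∈A)
  ... | yes 1∈A | no _      | yes 2∈A  | _         = all-diffs (2 , 2∈A , N∈A) (1 , 1∈A , N∈A)
  ... | yes 1∈A | no _      | no _     | yes N-2∈A = all-diffs (0 , 0∈A , N-2∈A) (1 , 1∈A , N∈A)
  ... | yes 1∈A | no N-1∉A  | no _     | no N-2∉A  = without-N-1,N-2 N-1∉A N-2∉A (1 , 1∈A , N∈A)
  ... | no _    | yes N-1∈A | yes 2∈A  | _         = all-diffs (2 , 2∈A , N∈A) (0 , 0∈A , N-1∈A)
  ... | no _    | yes N-1∈A | no _     | yes N-2∈A = all-diffs (0 , 0∈A , N-2∈A) (0 , 0∈A , N-1∈A)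
  ... | no 1∉A  | yes N-1∈A | no 2∉A   | no _      = without-1,2 1∉A 2∉A (0 , 0∈A , N-1∈A)
  ... | no 1∉A  | no N-1∉A  | yes 2∈A  | _         = without-1,N-1 1∉A N-1∉A (2 , 2∈A , N∈A)
  ... | no 1∉A  | no N-1∉A  | no _     | yes N-2∈A = without-1,N-1 1∉A N-1∉A (0 , 0∈A , N-2∈A)
  ... | no 1∉A  | no N-1∉A  | no 2∉A   | no N-2∉A  = without-corners 1∉A 2∉A N-1∉A N-2∉A

asFin : {N : ℕ} → Σ ℕ (_≤ N) → Fin (suc N)
asFin (x , x≤N) = fromℕ< (s≤s x≤N)

punctured : (N : ℕ) → List (Σ ℕ (_≤ N)) → Subset (suc N)
punctured N gaps = ∁ (pointSet (map asFin gaps))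

module Punctured (N : ℕ) (gaps : List (Σ ℕ (_≤ N))) where

  gapValues : List ℕ
  gapValues = map proj₁ gaps

  gapPoints : List (Fin (suc N))
  gapPoints = map asFin gaps

  ∣punctured∣ : suc N ∸ length gaps ≤ ∣ punctured N gaps ∣
  ∣punctured∣ = subst (suc N ∸ length gaps ≤_) (sym (∣∁p∣≡n∸∣p∣ (pointSet gapPoints)))
    (ℕ.∸-monoʳ-≤ (suc N) (subst (∣ pointSet gapPoints ∣ ≤_) (length-map asFin gaps) (∣pointSet∣≤length gapPoints)))

  ∈punctured⁺ : ∀ x → x ≤ N → x ∉ˡ gapValues → Contains (punctured N gaps) x
  ∈punctured⁺ x x≤N x∉gaps = fromℕ< (s≤s x≤N) , toℕ-fromℕ< (s≤s x≤N) , x∉p⇒x∈∁p x∉pointSet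
    where
    x∉pointSet : fromℕ< (s≤s x≤N) ∉ pointSet gapPoints
    x∉pointSet x∈ with (y , y≤N) , y∈gaps , e ← ∈-map⁻ asFin (∈pointSet⁻ gapPoints x∈) =
      x∉gaps (subst (_∈ˡ gapValues) (sym x≡y) (∈-map⁺ proj₁ y∈gaps))
      where
      x≡y : x ≡ y
      x≡y = trans (sym (toℕ-fromℕ< (s≤s x≤N))) (trans (cong toℕ e) (toℕ-fromℕ< (s≤s y≤N)))

  ∈punctured⁻ : ∀ {x} → Contains (punctured N gaps) x → x ∉ˡ gapValues
  ∈punctured⁻ (i , refl , i∈A) i∈gaps with (y , y≤N) , y∈gaps , e ← ∈-map⁻ proj₁ i∈gaps =
    x∈∁p⇒x∉p i∈A (∈pointSet⁺ gapPoints (subst (_∈ˡ gapPoints) (sym i≡y) (∈-map⁺ asFin y∈gaps)))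
    where
    i≡y : i ≡ fromℕ< (s≤s y≤N)
    i≡y = toℕ-injective (trans e (sym (toℕ-fromℕ< (s≤s y≤N))))

block-sums : {n : ℕ} (A : Subset n) (lo L c d : ℕ) → (∀ x → x ≤ L → Contains A (lo + x)) →
             Contains A c → Contains A (d + c) → d ≤ suc L → ∀ t → t ≤ d + L → IsSum A (lo + c + t)
block-sums A lo L c d block c∈A d+c∈A d≤1+L t t≤d+L with t ℕ.<? d
... | yes t<d = c , lo + t , c∈A , block t (ℕ.≤-pred (ℕ.≤-trans t<d d≤1+L)) ,
      trans (sym (ℕ.+-assoc c lo t)) (cong (_+ t) (ℕ.+-comm c lo))
... | no t≮d with u , refl ← ℕ.m≤n⇒∃[o]m+o≡n (ℕ.≮⇒≥ t≮d) =
      d + c , lo + u , d+c∈A , block u (ℕ.+-cancelˡ-≤ d u L t≤d+L) , rearrange c d lo u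
  where
  rearrange : ∀ c d lo u → (d + c) + (lo + u) ≡ lo + c + (d + u)
  rearrange = solve-∀

≤-or-beyond : ∀ s c → s ≤ c ⊎ Σ ℕ (λ u → s ≡ suc c + u)
≤-or-beyond s c with s ℕ.≤? c
... | yes s≤c = inj₁ s≤c
... | no s≰c = inj₂ (s ∸ suc c , sym (ℕ.m+[n∸m]≡n (ℕ.≰⇒> s≰c)))

-- Lower bound: for N = 18 + k, the set {0,…,N} ∖ {1, 4, 5, 6, N - 6, N - 4, N - 3} is sum-dominant:
-- A + A misses only 1 while A - A misses ±(N - 6).
module Construction (k : ℕ) where

  gaps : List (Σ ℕ (_≤ 18 + k))
  gaps = (1 , ℕ.m≤m+n 1 (17 + k)) ∷ (4 , ℕ.m≤m+n 4 (14 + k)) ∷ (5 , ℕ.m≤m+n 5 (13 + k)) ∷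
         (6 , ℕ.m≤m+n 6 (12 + k)) ∷ (12 + k , top≤N 12 6) ∷ (14 + k , top≤N 14 4) ∷ (15 + k , top≤N 15 3) ∷ []
    where
    top≤N : ∀ c m → c + k ≤ (c + m) + k
    top≤N c m = ℕ.+-monoˡ-≤ k (ℕ.m≤m+n c m)

  A : Subset (19 + k)
  A = punctured (18 + k) gaps

  open Punctured (18 + k) gaps

  0∈A : Contains A 0
  0∈A = ∈punctured⁺ 0 z≤n (All¬⇒¬Any ((λ ()) ∷ (λ ()) ∷ (λ ()) ∷ (λ ()) ∷ (λ ()) ∷ (λ ()) ∷ (λ ()) ∷ []))

  2∈A : Contains A 2
  2∈A = ∈punctured⁺ 2 (ℕ.m≤m+n 2 (16 + k))
    (All¬⇒¬Any ((λ ()) ∷ (λ ()) ∷ (λ ()) ∷ (λ ()) ∷ (λ ()) ∷ (λ ()) ∷ (λ ()) ∷ []))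

  3∈A : Contains A 3
  3∈A = ∈punctured⁺ 3 (ℕ.m≤m+n 3 (15 + k))
    (All¬⇒¬Any ((λ ()) ∷ (λ ()) ∷ (λ ()) ∷ (λ ()) ∷ (λ ()) ∷ (λ ()) ∷ (λ ()) ∷ []))

  block∈A : ∀ x → x ≤ 4 + k → Contains A (7 + x)
  block∈A x x≤4+k = ∈punctured⁺ (7 + x) (ℕ.≤-trans 7+x≤12+k (ℕ.+-monoˡ-≤ k (ℕ.m≤m+n 12 6)))
    (All¬⇒¬Any ((λ ()) ∷ (λ ()) ∷ (λ ()) ∷ (λ ()) ∷
                ℕ.<⇒≢ 7+x<12+k ∷ ℕ.<⇒≢ (ℕ.<-trans 7+x<12+k (ℕ.+-monoˡ-< k (ℕ.≤ᵇ⇒≤ 13 14 _))) ∷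
                ℕ.<⇒≢ (ℕ.<-trans 7+x<12+k (ℕ.+-monoˡ-< k (ℕ.≤ᵇ⇒≤ 13 15 _))) ∷ []))
    where
    7+x<12+k : 7 + x < 12 + k
    7+x<12+k = ℕ.+-monoʳ-≤ 8 x≤4+k
    7+x≤12+k : 7 + x ≤ 12 + k
    7+x≤12+k = ℕ.<⇒≤ 7+x<12+k

  top∈A : ∀ c → 7 ≤ c → c ≤ 18 → c ∉ˡ (12 ∷ 14 ∷ 15 ∷ []) → Contains A (c + k)
  top∈A c 7≤c c≤18 c∉ = ∈punctured⁺ (c + k) (ℕ.+-monoˡ-≤ k c≤18)
    (All¬⇒¬Any (below 1 (ℕ.≤ᵇ⇒≤ 1 6 _) ∷ below 4 (ℕ.≤ᵇ⇒≤ 4 6 _) ∷ below 5 (ℕ.≤ᵇ⇒≤ 5 6 _) ∷ below 6 ℕ.≤-refl ∷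
                shifted (here refl) ∷ shifted (there (here refl)) ∷ shifted (there (there (here refl))) ∷ []))
    where
    below : ∀ g → g ≤ 6 → c + k ≢ g
    below g g≤6 e = ℕ.<⇒≢ (ℕ.≤-trans (s≤s g≤6) (ℕ.≤-trans 7≤c (ℕ.m≤m+n c k))) (sym e)
    shifted : ∀ {g} → g ∈ˡ (12 ∷ 14 ∷ 15 ∷ []) → c + k ≢ g + k
    shifted g∈ e = c∉ (subst (_∈ˡ _) (sym (ℕ.+-cancelʳ-≡ k c _ e)) g∈)

  13∈A : Contains A (13 + k)
  13∈A = top∈A 13 (ℕ.≤ᵇ⇒≤ 7 13 _) (ℕ.≤ᵇ⇒≤ 13 18 _) (All¬⇒¬Any ((λ ()) ∷ (λ ()) ∷ (λ ()) ∷ []))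
  16∈A : Contains A (16 + k)
  16∈A = top∈A 16 (ℕ.≤ᵇ⇒≤ 7 16 _) (ℕ.≤ᵇ⇒≤ 16 18 _) (All¬⇒¬Any ((λ ()) ∷ (λ ()) ∷ (λ ()) ∷ []))
  17∈A : Contains A (17 + k)
  17∈A = top∈A 17 (ℕ.≤ᵇ⇒≤ 7 17 _) (ℕ.≤ᵇ⇒≤ 17 18 _) (All¬⇒¬Any ((λ ()) ∷ (λ ()) ∷ (λ ()) ∷ []))
  18∈A : Contains A (18 + k)
  18∈A = top∈A 18 (ℕ.≤ᵇ⇒≤ 7 18 _) ℕ.≤-refl (All¬⇒¬Any ((λ ()) ∷ (λ ()) ∷ (λ ()) ∷ []))

  low-sums : ∀ s → s ≤ 6 → s ≢ 1 → IsSum A s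
  low-sums 0 _ _ = 0 , 0 , 0∈A , 0∈A , refl
  low-sums 1 _ s≢1 = contradiction refl s≢1
  low-sums 2 _ _ = 0 , 2 , 0∈A , 2∈A , refl
  low-sums 3 _ _ = 0 , 3 , 0∈A , 3∈A , refl
  low-sums 4 _ _ = 2 , 2 , 2∈A , 2∈A , refl
  low-sums 5 _ _ = 2 , 3 , 2∈A , 3∈A , refl
  low-sums 6 _ _ = 3 , 3 , 3∈A , 3∈A , refl
  low-sums (suc (suc (suc (suc (suc (suc (suc _))))))) (s≤s (s≤s (s≤s (s≤s (s≤s (s≤s ())))))) _

  middle-sums : ∀ w → w ≤ 6 → IsSum A ((15 + w) + k)
  middle-sums 0 _ = 2 , 13 + k , 2∈A , 13∈A , refl
  middle-sums 1 _ = 0 , 16 + k , 0∈A , 16∈A , refl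
  middle-sums 2 _ = 0 , 17 + k , 0∈A , 17∈A , refl
  middle-sums 3 _ = 0 , 18 + k , 0∈A , 18∈A , refl
  middle-sums 4 _ = 3 , 16 + k , 3∈A , 16∈A , refl
  middle-sums 5 _ = 3 , 17 + k , 3∈A , 17∈A , refl
  middle-sums 6 _ = 3 , 18 + k , 3∈A , 18∈A , refl
  middle-sums (suc (suc (suc (suc (suc (suc (suc _))))))) (s≤s (s≤s (s≤s (s≤s (s≤s (s≤s ()))))))

  pair : ∀ a b → Contains A (a + k) → Contains A (b + k) → IsSum A ((a + b) + (k + k))
  pair a b a∈A b∈A = a + k , b + k , a∈A , b∈A , interchange a k b k

  top-sums : ∀ z → z ≤ 6 → IsSum A ((30 + z) + (k + k))
  top-sums 0 _ = pair 13 17 13∈A 17∈A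
  top-sums 1 _ = pair 13 18 13∈A 18∈A
  top-sums 2 _ = pair 16 16 16∈A 16∈A
  top-sums 3 _ = pair 16 17 16∈A 17∈A
  top-sums 4 _ = pair 17 17 17∈A 17∈A
  top-sums 5 _ = pair 17 18 17∈A 18∈A
  top-sums 6 _ = pair 18 18 18∈A 18∈A
  top-sums (suc (suc (suc (suc (suc (suc (suc _))))))) (s≤s (s≤s (s≤s (s≤s (s≤s (s≤s ()))))))

  -- the ranges above, as they arise from successive case splits
  private
    at-middle : ∀ k w → (15 + w) + k ≡ 7 + (suc (7 + k) + w)
    at-middle = solve-∀
    at-upper-block : ∀ k v → 7 + (13 + k) + (2 + v) ≡ 7 + (suc (7 + k) + (7 + v))
    at-upper-block = solve-∀
    at-top : ∀ k z → (30 + z) + (k + k) ≡ 7 + (suc (7 + k) + (7 + (suc (7 + k) + z)))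
    at-top = solve-∀

  -- every s ∈ [0, 2N] except 1 is a sum; besides the three tables above, the ranges
  -- [7, N - 4] = {0, 3} + block and [N + 4, 2N - 7] = {N - 5, N} + block are covered
  all-sums : ∀ s → s ≤ (18 + k) + (18 + k) → s ≢ 1 → IsSum A s
  all-sums s s≤2N s≢1 with ≤-or-beyond s 6
  ... | inj₁ s≤6 = low-sums s s≤6 s≢1
  ... | inj₂ (t , refl) with ≤-or-beyond t (7 + k)
  ...   | inj₁ t≤7+k = block-sums A 7 (4 + k) 0 3 block∈A 0∈A 3∈A (ℕ.m≤m+n 3 (2 + k)) t t≤7+k
  ...   | inj₂ (w , refl) with ≤-or-beyond w 6
  ...     | inj₁ w≤6 = subst (IsSum A) (at-middle k w) (middle-sums w w≤6)
  ...     | inj₂ (v , refl) with ≤-or-beyond v (7 + k)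
  ...       | inj₁ v≤7+k = subst (IsSum A) (at-upper-block k v)
                (block-sums A 7 (4 + k) (13 + k) 5 block∈A 13∈A 18∈A (ℕ.m≤m+n 5 k) (2 + v) (s≤s (s≤s v≤7+k)))
  ...       | inj₂ (z , refl) = subst (IsSum A) (at-top k z) (top-sums z z≤6)
    where
    z≤6 : z ≤ 6
    z≤6 = ℕ.+-cancelˡ-≤ 30 z 6 (ℕ.+-cancelʳ-≤ (k + k) (30 + z) 36
            (subst₂ _≤_ (sym (at-top k z)) (interchange 18 k 18 k) s≤2N))

  -- N - 6 is not a difference: b + (N - 6) ∈ A forces b ≤ 6, and for b ∈ {0, 2, 3} the
  -- element b + (N - 6) is one of the gaps N - 6, N - 4, N - 3
  no-diff : ¬ IsDiff A (12 + k)
  no-diff (b , b∈A , c∈A) = excluded b (ℕ.+-cancelʳ-≤ (12 + k) b 6 (Window.contains-≤ (18 + k) A c∈A)) b∈A c∈A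
    where
    excluded : ∀ b → b ≤ 6 → Contains A b → ¬ Contains A (b + (12 + k))
    excluded 0 _ _ c∈A = ∈punctured⁻ c∈A (there (there (there (there (here refl)))))
    excluded 1 _ b∈A _ = ∈punctured⁻ b∈A (here refl)
    excluded 2 _ _ c∈A = ∈punctured⁻ c∈A (there (there (there (there (there (here refl))))))
    excluded 3 _ _ c∈A = ∈punctured⁻ c∈A (there (there (there (there (there (there (here refl)))))))
    excluded 4 _ b∈A _ = ∈punctured⁻ b∈A (there (here refl))
    excluded 5 _ b∈A _ = ∈punctured⁻ b∈A (there (there (here refl)))
    excluded 6 _ b∈A _ = ∈punctured⁻ b∈A (there (there (there (here refl))))
    excluded (suc (suc (suc (suc (suc (suc (suc _))))))) (s≤s (s≤s (s≤s (s≤s (s≤s (s≤s ())))))) _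

  admissible : Admissible (19 + k) A
  admissible = Window.dominant-if (18 + k) A 1 all-sums (12 + k) (s≤s z≤n) (ℕ.+-monoˡ-≤ k (ℕ.m≤m+n 12 6)) no-diff
             , 0∈A , 18∈A

  large : 12 + k ≤ ∣ A ∣
  large = ∣punctured∣

admissible? : (n : ℕ) (A : Subset n) → Dec (Admissible n A)
admissible? n A = (diffSetCard A ℕ.<? sumSetCard A) ×-dec (contains? A 0 ×-dec contains? A (n ∸ 1))

witness₁₆ : Subset 16
witness₁₆ = pointSet (# 0 ∷ # 1 ∷ # 3 ∷ # 7 ∷ # 8 ∷ # 11 ∷ # 13 ∷ # 14 ∷ # 15 ∷ [])

witness₁₇ : Subset 17
witness₁₇ = pointSet (# 0 ∷ # 2 ∷ # 3 ∷ # 7 ∷ # 8 ∷ # 9 ∷ # 11 ∷ # 14 ∷ # 15 ∷ # 16 ∷ [])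

witness₁₈ : Subset 18
witness₁₈ = pointSet (# 0 ∷ # 2 ∷ # 3 ∷ # 7 ∷ # 8 ∷ # 9 ∷ # 10 ∷ # 12 ∷ # 15 ∷ # 16 ∷ # 17 ∷ [])

admissible-witness : ∀ k → Σ (Subset (16 + k)) λ A → Admissible (16 + k) A × 9 + k ≤ ∣ A ∣
admissible-witness 0 = witness₁₆ , toWitness {a? = admissible? 16 witness₁₆} _ , ℕ.≤-refl
admissible-witness 1 = witness₁₇ , toWitness {a? = admissible? 17 witness₁₇} _ , ℕ.≤-refl
admissible-witness 2 = witness₁₈ , toWitness {a? = admissible? 18 witness₁₈} _ , ℕ.≤-refl
admissible-witness (suc (suc (suc k))) = Construction.A k , Construction.admissible k , Construction.large k

admissible-size : ∀ k (A : Subset (16 + k)) → Admissible (16 + k) A → ∣ A ∣ ≤ 12 + k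
admissible-size k A (dominant , 0∈A , N∈A) with ∣ A ∣ ℕ.≤? 12 + k
... | yes small = small
... | no large = contradiction dominant (LargeSets.not-dominant k A (ℕ.+-monoʳ-≤ 4 (ℕ.≰⇒> large)) 0∈A N∈A)

IsLargest : {n : ℕ} → (Subset n → Set) → ℕ → Set
IsLargest {n} P N = Σ (Subset n) (λ A → P A × ∣ A ∣ ≡ N) × ((A : Subset n) → P A → ∣ A ∣ ≤ N)

largest-exists : {n : ℕ} {P : Subset n → Set} → (∀ A → Dec (P A)) → Σ (Subset n) P → Σ ℕ (IsLargest P)
largest-exists {n} {P} P? (A₀ , P₀) = search n (λ A _ → ∣p∣≤n A)
  where
  -- given that all sizes are ≤ u, look for a P-set of size ≥ u, else lower u
  search : ∀ u → (∀ A → P A → ∣ A ∣ ≤ u) → Σ ℕ (IsLargest P)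
  search u bound with anySubset? (λ A → P? A ×-dec (u ℕ.≤? ∣ A ∣))
  ... | yes (A , PA , u≤∣A∣) = ∣ A ∣ , (A , PA , refl) , λ B PB → ℕ.≤-trans (bound B PB) u≤∣A∣
  search zero bound | no none = contradiction (A₀ , P₀ , z≤n) none
  search (suc u) bound | no none = search u λ A PA → ℕ.≤-pred (ℕ.≰⇒> λ 1+u≤∣A∣ → none (A , PA , 1+u≤∣A∣))

largest-bounds : ∀ k N → IsLargestAdmissibleCard (16 + k) N → 9 + k ≤ N × N ≤ 12 + k
largest-bounds k N ((A , A-admissible , refl) , maximal) with W , W-admissible , 9+k≤∣W∣ ← admissible-witness k =
  ℕ.≤-trans 9+k≤∣W∣ (maximal W W-admissible) , admissible-size k A A-admissible

largest-admissible : ∀ k → Σ ℕ λ N → IsLargestAdmissibleCard (16 + k) N × 9 + k ≤ N × N ≤ 12 + k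
largest-admissible k = map₂ (λ {N} largest → largest , largest-bounds k N largest)
  (largest-exists (admissible? (16 + k)) (proj₁ (admissible-witness k) , proj₁ (proj₂ (admissible-witness k))))

theorem2 : (n : ℕ) → 16 ≤ n →
    Σ ℕ (λ N → IsLargestAdmissibleCard n N × n ∸ 7 ≤ N × N ≤ n ∸ 4)
theorem2 n 16≤n = subst (λ m → Σ ℕ (λ N → IsLargestAdmissibleCard m N × m ∸ 7 ≤ N × N ≤ m ∸ 4))
  (ℕ.m+[n∸m]≡n 16≤n) (largest-admissible (n ∸ 16))
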